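{- Let $p,d\geq1$ and $\epsilon\in\{+1,-1\}^{p\times d}$. The tropically allowed lattice paths for $\epsilon$ are in one-to-one correspondence with the words over $\{\mathsf{d},\mathsf{r}\}$ accepted by the automaton $\mathcal{A}$ (with respect to $\epsilon$), and for each accepted word there is exactly one sequence of arcs of $\mathcal{A}$ realizing it.
   Context: Tropically allowed lattice paths: a lattice path in the $p\times d$ grid is given by $k\geq0$ and $1\leq i_1<\cdots<i_k\leq p$, $1\leq j_1<\cdots<j_{k+1}\leq d$; it is the sequence of positions $(1,j_1),\ldots,(i_1,j_1),\ldots,(i_1,j_2),\ldots,(i_2,j_2),\ldots,(i_k,j_{k+1}),\ldots,(p,j_{k+1})$. It is tropically allowed for $\epsilon$ if: (C1) if $k\geq1$, $\epsilon_{ij_1}=+1$ for $1\leq i<i_1$; (C2) if $k\geq1$, $\epsilon_{ij_{k+1}}=+1$ for $i_k<i\leq p$, and if $k=0$, $\epsilon_{ij_1}=+1$ for all $i$; (C3) for $2\leq r\leq k$, $\epsilon_{ij_r}=+1$ for $i_{r-1}<i<i_r$; (C4) for each $r$, $(\epsilon_{i_rj_r},\epsilon_{i_rj_{r+1}})\in\{(+1,-1),(-1,+1)\}$; (C5) if $(\epsilon_{i_rj_r},\epsilon_{i_rj_{r+1}})=(-1,+1)$ for some $r$, then the same holds for all $s\geq r$. Automaton $\mathcal{A}$: states $1,+,-,+-,-+$; initial state $1$; final states $+-$ and $-+$. Arcs are labeled by a letter ($\mathsf{d}$ = down, $\mathsf{r}$ = right) and possibly a sign: $1\xrightarrow{\mathsf{r}}1$;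 $1\xrightarrow{\mathsf{d}}{+- }$; ${+- }\xrightarrow{+\mathsf{d}}{+- }$; ${+- }\xrightarrow{+\mathsf{r}}{+}$; ${+- }\xrightarrow{ -\mathsf{r}}{ - }$; ${+}\xrightarrow{\mathsf{r}}{+}$; ${+}\xrightarrow{ -\mathsf{d}}{+- }$; ${ - }\xrightarrow{\mathsf{r}}{ - }$; ${ - }\xrightarrow{+\mathsf{d}}{ -+}$; ${ -+}\xrightarrow{+\mathsf{d}}{ -+}$; ${ -+}\xrightarrow{ -\mathsf{r}}{ - }$. Acceptance: the sign table $\epsilon$ is extended by a dummy row $0$ on top and a dummy row $p+1$ at the bottom, carrying no signs. A word $w$ is read letter by letter starting from position $(0,1)$ and state $1$; at each step, from current position $(i,j)$ and state $s$, the current letter must label an arc leaving $s$, and if that arc carries a sign $\sigma$, then $1\leq i\leq p$ and $\epsilon_{ij}=\sigma$ are required; the move sends the position to $(i+1,j)$ for $\mathsf{d}$ or $(i,j+1)$ for $\mathsf{r}$, and the state to the arc's target. The word is accepted if every step is possible in this way, the final state is $+-$ or $-+$, and the final position is $(p+1,j)$ with $1\leq j\leq d$ (i.e. the word has exactly $p+1$ letters $\mathsf{d}$ and at most $d-1$ letters $\mathsf{r}$). -}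

module Defs where

open import Data.Nat using (ℕ; zero; suc; _≤_; _<_; _∸_; _≤?_)
open import Data.Fin using (Fin; fromℕ<)
open import Data.List using (List; []; _∷_; length; replicate; _++_)
open import Data.Maybe using (Maybe; just; nothing)
open import Data.Product using (Σ; _×_; _,_)
open import Data.Sum using (_⊎_)
open import Data.Unit using (⊤)
open import Data.Sign using (Sign) renaming (+ to pos; - to neg) public
open import Relation.Nullary using (yes; no)
open import Relation.Binary.PropositionalEquality using (_≡_)

-- All indices below are the
-- paper's 1-based natural numbers; `entry ε i j` is ε_{ij} for
-- 1 ≤ i ≤ p, 1 ≤ j ≤ d and `nothing` outside the table (e.g. on the
-- dummy rows 0 and p+1).

SignTable : ℕ → ℕ → Set
SignTable p d = Fin p → Fin d → Sign

entry : ∀ {p d} → SignTable p d → ℕ → ℕ → Maybe Sign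
entry {p} {d} ε zero j = nothing
entry {p} {d} ε (suc i) zero = nothing
entry {p} {d} ε (suc i) (suc j) with suc i ≤? p | suc j ≤? d
... | yes i<p | yes j<d = just (ε (fromℕ< i<p) (fromℕ< j<d))
... | yes _ | no _ = nothing
... | no _ | _ = nothing

_⟨_,_⟩≡_ : ∀ {p d} → SignTable p d → ℕ → ℕ → Sign → Set
ε ⟨ i , j ⟩≡ σ = entry ε i j ≡ just σ

-- Lattice paths.  A path is the raw data (i_1,…,i_k) and
-- (j_1,…,j_{k+1}) as lists; `at xs r` is the r-th entry (1-based).

record Path : Set where
  constructor path
  field
    rows : List ℕ
    cols : List ℕ

open Path public

at : List ℕ → ℕ → ℕ
at [] _ = 0
at (x ∷ xs) zero = 0
at (x ∷ xs) (suc zero) = x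
at (x ∷ xs) (suc (suc r)) = at xs (suc r)

IsLatticePath : ℕ → ℕ → Path → Set
IsLatticePath p d P =
  let k = length (rows P)
      i = at (rows P)
      j = at (cols P)
  in length (cols P) ≡ suc k
   × (∀ r → 1 ≤ r → r ≤ k → 1 ≤ i r × i r ≤ p)
   × (∀ r → 1 ≤ r → r < k → i r < i (suc r))
   × (∀ r → 1 ≤ r → r ≤ suc k → 1 ≤ j r × j r ≤ d)
   × (∀ r → 1 ≤ r → r < suc k → j r < j (suc r))

TropicallyAllowed : ∀ {p d} → SignTable p d → Path → Set
TropicallyAllowed {p} {d} ε P =
  let k = length (rows P)
      i = at (rows P)
      j = at (cols P)
  in
     (1 ≤ k → ∀ a → 1 ≤ a → a < i 1 → ε ⟨ a , j 1 ⟩≡ pos)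
   × (1 ≤ k → ∀ a → i k < a → a ≤ p → ε ⟨ a , j (suc k) ⟩≡ pos)
   × (k ≡ 0 → ∀ a → 1 ≤ a → a ≤ p → ε ⟨ a , j 1 ⟩≡ pos)
   × (∀ r → 2 ≤ r → r ≤ k → ∀ a → i (r ∸ 1) < a → a < i r → ε ⟨ a , j r ⟩≡ pos)
   × (∀ r → 1 ≤ r → r ≤ k →
        (ε ⟨ i r , j r ⟩≡ pos × ε ⟨ i r , j (suc r) ⟩≡ neg)
      ⊎ (ε ⟨ i r , j r ⟩≡ neg × ε ⟨ i r , j (suc r) ⟩≡ pos))
   × (∀ r s → 1 ≤ r → r ≤ s → s ≤ k →
        (ε ⟨ i r , j r ⟩≡ neg × ε ⟨ i r , j (suc r) ⟩≡ pos) →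
        (ε ⟨ i s , j s ⟩≡ neg × ε ⟨ i s , j (suc s) ⟩≡ pos))

data Letter : Set where
  𝖽 𝗋 : Letter

Word : Set
Word = List Letter

-- The word traced by the path when started from the dummy position (0,1):
-- r^{j_1-1} d^{i_1} r^{j_2-j_1} d^{i_2-i_1} ⋯ r^{j_{k+1}-j_k} d^{p+1-i_k}.
pathWord′ : ℕ → ℕ → ℕ → List ℕ → List ℕ → Word
pathWord′ p a b (x ∷ xs) (y ∷ ys) =
  replicate (y ∸ b) 𝗋 ++ replicate (x ∸ a) 𝖽 ++ pathWord′ p x y xs ys
pathWord′ p a b [] (y ∷ ys) = replicate (y ∸ b) 𝗋 ++ replicate (suc p ∸ a) 𝖽
pathWord′ p a b _ [] = []

pathWord : ℕ → Path → Word
pathWord p P = pathWord′ p 0 1 (rows P) (cols P)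

data State : Set where
  s1 s+ s- s+- s-+ : State

data Final : State → Set where
  fin+- : Final s+-
  fin-+ : Final s-+

-- The eleven arcs of 𝒜; aXYZ = arc from X with letter/sign Y to Z,
-- P = +, M = -, PM = +-, MP = -+, p/m = sign +/- on the arc.
data Arc : Set where
  a1r1 a1dPM aPMpdPM aPMprP aPMmrM aPrP aPmdPM aMrM aMpdMP aMPpdMP aMPmrM : Arc

source : Arc → State
source a1r1 = s1
source a1dPM = s1
source aPMpdPM = s+-
source aPMprP = s+-
source aPMmrM = s+-
source aPrP = s+
source aPmdPM = s+
source aMrM = s-
source aMpdMP = s-
source aMPpdMP = s-+
source aMPmrM = s-+

target : Arc → State
target a1r1 = s1
target a1dPM = s+-
target aPMpdPM = s+-
target aPMprP = s+
target aPMmrM = s-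
target aPrP = s+
target aPmdPM = s+-
target aMrM = s-
target aMpdMP = s-+
target aMPpdMP = s-+
target aMPmrM = s-

label : Arc → Letter
label a1r1 = 𝗋
label a1dPM = 𝖽
label aPMpdPM = 𝖽
label aPMprP = 𝗋
label aPMmrM = 𝗋
label aPrP = 𝗋
label aPmdPM = 𝖽
label aMrM = 𝗋
label aMpdMP = 𝖽
label aMPpdMP = 𝖽
label aMPmrM = 𝗋

arcSign : Arc → Maybe Sign
arcSign a1r1 = nothing
arcSign a1dPM = nothing
arcSign aPMpdPM = just pos
arcSign aPMprP = just pos
arcSign aPMmrM = just neg
arcSign aPrP = nothing
arcSign aPmdPM = just neg
arcSign aMrM = nothing
arcSign aMpdMP = just pos
arcSign aMPpdMP = just pos
arcSign aMPmrM = just neg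

SignOK : ∀ {p d} → SignTable p d → Maybe Sign → ℕ → ℕ → Set
SignOK ε nothing i j = ⊤
SignOK ε (just σ) i j = ε ⟨ i , j ⟩≡ σ

stepRow : Letter → ℕ → ℕ
stepRow 𝖽 i = suc i
stepRow 𝗋 i = i

stepCol : Letter → ℕ → ℕ
stepCol 𝖽 j = j
stepCol 𝗋 j = suc j

data Run {p d : ℕ} (ε : SignTable p d) : State → ℕ → ℕ → Word → Set where
  stop : ∀ {s j} → Final s → 1 ≤ j → j ≤ d → Run ε s (suc p) j []
  step : ∀ {s i j ℓ w} (a : Arc) → source a ≡ s → label a ≡ ℓ →
         SignOK ε (arcSign a) i j →
         Run ε (target a) (stepRow ℓ i) (stepCol ℓ j) w →
         Run ε s i j (ℓ ∷ w)

Accepted : ∀ {p d} → SignTable p d → Word → Set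
Accepted ε w = Run ε s1 0 1 w

arcs : ∀ {p d} {ε : SignTable p d} {s i j w} → Run ε s i j w → List Arc
arcs (stop _ _ _) = []
arcs (step a _ _ _ r) = a ∷ arcs r

AllowedPath : ∀ {p d} → SignTable p d → Path → Set
AllowedPath {p} {d} ε P = IsLatticePath p d P × TropicallyAllowed ε P

-- Read from top to bottom, a tropically allowed path is a sequence of steps down through
-- entries +1 and of turns whose two entries have opposite signs, where after a (−,+) turn
-- every later turn is (−,+) by (C5).  Remembering whether such a turn has occurred, this is
-- literally a run of 𝒜: a down step is a signed 𝖽-loop at +− or −+, and a turn is a signed 𝗋
-- into + or −, unsigned 𝗋-loops, and a signed 𝖽 back.  A path is recovered from its word
-- because every turn starts with an 𝗋, and the run is unique because 𝒜 is deterministic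
-- once the entry at the current position is known.
module Submission where

open import Defs
open import Data.Nat
  using (ℕ; zero; suc; _≤_; _<_; _∸_; _+_; z≤n; s≤s; _≤?_; _≤′_; ≤′-refl; ≤′-step)
open import Data.Nat.Properties
  using (≤-refl; ≤-trans; <-≤-trans; <⇒≤; <⇒≱; ≤-pred; n≤1+n; m<n⇒m<1+n; m≤n⇒m<n∨m≡n;
         ≤⇒≤′; ≤′⇒≤; 1+n≰n; suc-injective; +-suc; +-∸-assoc; n∸n≡0; m+n∸n≡m; m∸n+n≡m;
         ∸-cancelʳ-≡)
open import Data.List using (List; []; _∷_; length; replicate; _++_)
open import Data.List.Properties using (∷-injective; ++-identityʳ)
open import Data.Maybe using (Maybe; just; nothing)
open import Data.Product using (Σ; _×_; _,_; proj₁; proj₂; map₁)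
open import Data.Sum using (_⊎_; inj₁; inj₂)
open import Data.Unit using (⊤; tt)
open import Data.Empty using (⊥; ⊥-elim)
open import Relation.Nullary using (yes; no)
open import Relation.Binary.PropositionalEquality
  using (_≡_; _≢_; refl; sym; trans; cong; cong₂; subst; module ≡-Reasoning)

replicate-∸-suc : ∀ {A : Set} (a : A) {j y} → j < y →
  replicate (y ∸ j) a ≡ a ∷ replicate (y ∸ suc j) a
replicate-∸-suc a (s≤s j≤y) = cong (λ n → replicate n a) (+-∸-assoc 1 j≤y)

replicate-suc-++ : ∀ {A : Set} (a : A) n (u : List A) →
  replicate (suc n) a ++ u ≡ replicate n a ++ a ∷ u
replicate-suc-++ a zero u = refl
replicate-suc-++ a (suc n) u = cong (a ∷_) (replicate-suc-++ a n u)

replicate-++-cancel : ∀ {A : Set} {a b : A} → a ≢ b → ∀ m n {u v : List A} →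
  replicate m a ++ b ∷ u ≡ replicate n a ++ b ∷ v → m ≡ n × u ≡ v
replicate-++-cancel a≢b zero zero e = refl , proj₂ (∷-injective e)
replicate-++-cancel a≢b zero (suc n) e = ⊥-elim (a≢b (sym (proj₁ (∷-injective e))))
replicate-++-cancel a≢b (suc m) zero e = ⊥-elim (a≢b (proj₁ (∷-injective e)))
replicate-++-cancel a≢b (suc m) (suc n) e =
  map₁ (cong suc) (replicate-++-cancel a≢b m n (proj₂ (∷-injective e)))

extend-downwards : ∀ {P Q : ℕ → Set} {i} → P i → (∀ a → suc i ≤ a → Q a → P a) →
  ∀ a → i ≤ a → Q a → P a
extend-downwards Pi above a i≤a q with m≤n⇒m<n∨m≡n i≤a
... | inj₁ i<a = above a i<a q
... | inj₂ refl = Pi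

increasing⇒first≤ : (f : ℕ → ℕ) (k : ℕ) → (∀ r → 1 ≤ r → r < k → f r < f (suc r)) →
  ∀ r → 1 ≤ r → r ≤ k → f 1 ≤ f r
increasing⇒first≤ f k inc (suc zero) _ _ = ≤-refl
increasing⇒first≤ f k inc (suc (suc r)) _ r<k =
  ≤-trans (increasing⇒first≤ f k inc (suc r) (s≤s z≤n) (≤-trans (n≤1+n _) r<k))
          (<⇒≤ (inc (suc r) (s≤s z≤n) r<k))

vacuous-range : ∀ {A : Set} {r} → 1 ≤ r → r ≤ 0 → A
vacuous-range (s≤s _) ()

𝗋≢𝖽 : 𝗋 ≢ 𝖽
𝗋≢𝖽 ()

-- Only +− has two arcs with the same letter, and they carry opposite signs.
arcFor : State → Letter → Maybe Sign → Arc
arcFor s1 𝗋 _ = a1r1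
arcFor s1 𝖽 _ = a1dPM
arcFor s+- 𝖽 _ = aPMpdPM
arcFor s+- 𝗋 (just neg) = aPMmrM
arcFor s+- 𝗋 _ = aPMprP
arcFor s+ 𝗋 _ = aPrP
arcFor s+ 𝖽 _ = aPmdPM
arcFor s- 𝗋 _ = aMrM
arcFor s- 𝖽 _ = aMpdMP
arcFor s-+ 𝖽 _ = aMPpdMP
arcFor s-+ 𝗋 _ = aMPmrM

-- mp: a (−,+) turn has already occurred, so by (C5) all remaining turns are (−,+).
data Mode : Set where
  pm mp : Mode

state : Mode → State
state pm = s+-
state mp = s-+

final : ∀ m → Final (state m)
final pm = fin+-
final mp = fin-+

module _ {p d : ℕ} (ε : SignTable p d) where

  entry-bounds : ∀ {i j σ} → ε ⟨ i , j ⟩≡ σ → 1 ≤ i × i ≤ p × 1 ≤ j × j ≤ d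
  entry-bounds {zero} ()
  entry-bounds {suc i} {zero} ()
  entry-bounds {suc i} {suc j} e with suc i ≤? p | suc j ≤? d
  ... | yes i≤p | yes j≤d = s≤s z≤n , i≤p , s≤s z≤n , j≤d
  entry-bounds {suc i} {suc j} () | yes _ | no _
  entry-bounds {suc i} {suc j} () | no _ | _

  pos≢neg : ∀ {i j} → ε ⟨ i , j ⟩≡ pos → ε ⟨ i , j ⟩≡ neg → ⊥
  pos≢neg e e′ with trans (sym e) e′
  ... | ()

  arcFor-correct : ∀ a {i j} → SignOK ε (arcSign a) i j →
    arcFor (source a) (label a) (entry ε i j) ≡ a
  arcFor-correct a1r1 _ = refl
  arcFor-correct a1dPM _ = refl
  arcFor-correct aPMpdPM _ = refl
  arcFor-correct aPMprP e rewrite e = refl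
  arcFor-correct aPMmrM e rewrite e = refl
  arcFor-correct aPrP _ = refl
  arcFor-correct aPmdPM _ = refl
  arcFor-correct aMrM _ = refl
  arcFor-correct aMpdMP _ = refl
  arcFor-correct aMPpdMP _ = refl
  arcFor-correct aMPmrM _ = refl

  arc-deterministic : ∀ {a a′ i j} → source a ≡ source a′ → label a ≡ label a′ →
    SignOK ε (arcSign a) i j → SignOK ε (arcSign a′) i j → a ≡ a′
  arc-deterministic {a} {a′} {i} {j} s≡ ℓ≡ ok ok′ = begin
    a                                           ≡⟨ sym (arcFor-correct a ok) ⟩
    arcFor (source a) (label a) (entry ε i j)   ≡⟨ cong₂ (λ s ℓ → arcFor s ℓ (entry ε i j)) s≡ ℓ≡ ⟩
    arcFor (source a′) (label a′) (entry ε i j) ≡⟨ arcFor-correct a′ ok′ ⟩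
    a′                                          ∎
    where open ≡-Reasoning

  arcs-unique : ∀ {s i j w} (r r′ : Run ε s i j w) → arcs r ≡ arcs r′
  arcs-unique (stop _ _ _) (stop _ _ _) = refl
  arcs-unique (step a refl refl ok r) (step a′ s≡ ℓ≡ ok′ r′)
    with arc-deterministic {a} {a′} (sym s≡) (sym ℓ≡) ok ok′
  ... | refl = cong (a ∷_) (arcs-unique r r′)

  data Turn (i j y : ℕ) : Mode → Mode → Set where
    +- : ε ⟨ i , j ⟩≡ pos → ε ⟨ i , y ⟩≡ neg → Turn i j y pm pm
    -+ : ∀ {m} → ε ⟨ i , j ⟩≡ neg → ε ⟨ i , y ⟩≡ pos → Turn i j y m mp

  -- The part of an allowed path from position (i, j) on, with remaining turning rows xs and
  -- later columns ys.
  data Tail : Mode → ℕ → ℕ → List ℕ → List ℕ → Set where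
    done : ∀ {m j} → 1 ≤ j → j ≤ d → Tail m (suc p) j [] []
    down : ∀ {m i j xs ys} → ε ⟨ i , j ⟩≡ pos → Tail m (suc i) j xs ys → Tail m i j xs ys
    turn : ∀ {m m′ i j y xs ys} → j < y → Turn i j y m m′ → Tail m′ (suc i) y xs ys →
           Tail m i j (i ∷ xs) (y ∷ ys)

  tailWord : ∀ {m i j xs ys} → Tail m i j xs ys → Word
  tailWord (done _ _) = []
  tailWord (down _ t) = 𝖽 ∷ tailWord t
  tailWord (turn {j = j} {y} _ _ t) = 𝗋 ∷ replicate (y ∸ suc j) 𝗋 ++ 𝖽 ∷ tailWord t

  turn-bounds : ∀ {m m′ i j y} → Turn i j y m m′ → 1 ≤ i × i ≤ p × 1 ≤ j × j ≤ d
  turn-bounds (+- ok _) = entry-bounds ok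
  turn-bounds (-+ ok _) = entry-bounds ok

  tail-column-bounds : ∀ {m i j xs ys} → Tail m i j xs ys → 1 ≤ j × j ≤ d
  tail-column-bounds (done 1≤j j≤d) = 1≤j , j≤d
  tail-column-bounds {i = i} {j} (down ok _) = proj₂ (proj₂ (entry-bounds {i} {j} ok))
  tail-column-bounds (turn _ τ _) = proj₂ (proj₂ (turn-bounds τ))

  pathWord′-tailWord : ∀ {m a b i j xs ys} (t : Tail m i j xs ys) → a ≤ i →
    pathWord′ p a b xs (j ∷ ys) ≡ replicate (j ∸ b) 𝗋 ++ replicate (i ∸ a) 𝖽 ++ tailWord t
  pathWord′-tailWord {b = b} {j = j} (done _ _) _ =
    cong (replicate (j ∸ b) 𝗋 ++_) (sym (++-identityʳ _))
  pathWord′-tailWord {a = a} {b} {i} {j} {xs} {ys} (down _ t) a≤i = begin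
    pathWord′ p a b xs (j ∷ ys)
      ≡⟨ pathWord′-tailWord t (≤-trans a≤i (n≤1+n i)) ⟩
    R ++ replicate (suc i ∸ a) 𝖽 ++ tailWord t
      ≡⟨ cong (λ n → R ++ replicate n 𝖽 ++ tailWord t) (+-∸-assoc 1 a≤i) ⟩
    R ++ replicate (suc (i ∸ a)) 𝖽 ++ tailWord t
      ≡⟨ cong (R ++_) (replicate-suc-++ 𝖽 (i ∸ a) (tailWord t)) ⟩
    R ++ replicate (i ∸ a) 𝖽 ++ 𝖽 ∷ tailWord t
      ∎
    where
    open ≡-Reasoning
    R = replicate (j ∸ b) 𝗋
  pathWord′-tailWord {a = a} {b} {i} {j} (turn {y = y} {xs} {ys} j<y _ t) _ =
    cong (λ u → replicate (j ∸ b) 𝗋 ++ replicate (i ∸ a) 𝖽 ++ u) (begin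
      pathWord′ p i j xs (y ∷ ys)
        ≡⟨ pathWord′-tailWord t (n≤1+n i) ⟩
      replicate (y ∸ j) 𝗋 ++ replicate (suc i ∸ i) 𝖽 ++ tailWord t
        ≡⟨ cong₂ (λ u n → u ++ replicate n 𝖽 ++ tailWord t)
                 (replicate-∸-suc 𝗋 j<y) (m+n∸n≡m 1 i) ⟩
      𝗋 ∷ replicate (y ∸ suc j) 𝗋 ++ 𝖽 ∷ tailWord t
        ∎)
    where open ≡-Reasoning

  run-down : ∀ m {i j w} → ε ⟨ i , j ⟩≡ pos → Run ε (state m) (suc i) j w →
    Run ε (state m) i j (𝖽 ∷ w)
  run-down pm = step aPMpdPM refl refl
  run-down mp = step aMPpdMP refl refl

  run-loop : (a : Arc) → source a ≡ target a → label a ≡ 𝗋 → arcSign a ≡ nothing →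
    ∀ {i j y w} → j ≤ y → Run ε (target a) i y w →
    Run ε (target a) i j (replicate (y ∸ j) 𝗋 ++ w)
  run-loop a s≡t ℓ≡𝗋 unsigned {i} {j} {y} {w} j≤y r =
    loops (y ∸ j) (subst (λ k → Run ε (target a) i k w) (sym (m∸n+n≡m j≤y)) r)
    where
    loops : ∀ n {j} → Run ε (target a) i (n + j) w → Run ε (target a) i j (replicate n 𝗋 ++ w)
    loops zero r = r
    loops (suc n) {j} r =
      step a s≡t ℓ≡𝗋 (subst (λ τ → SignOK ε τ i j) (sym unsigned) tt)
        (loops n (subst (λ k → Run ε (target a) i k w) (sym (+-suc n j)) r))

  run-turn : ∀ {m m′ i j y w} → Turn i j y m m′ → j < y → Run ε (state m′) (suc i) y w →
    Run ε (state m) i j (𝗋 ∷ replicate (y ∸ suc j) 𝗋 ++ 𝖽 ∷ w)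
  run-turn {pm} (+- ok ok′) j<y r =
    step aPMprP refl refl ok (run-loop aPrP refl refl refl j<y (step aPmdPM refl refl ok′ r))
  run-turn {pm} (-+ ok ok′) j<y r =
    step aPMmrM refl refl ok (run-loop aMrM refl refl refl j<y (step aMpdMP refl refl ok′ r))
  run-turn {mp} (-+ ok ok′) j<y r =
    step aMPmrM refl refl ok (run-loop aMrM refl refl refl j<y (step aMpdMP refl refl ok′ r))

  run : ∀ {m i j xs ys} (t : Tail m i j xs ys) → Run ε (state m) i j (tailWord t)
  run {m} (done 1≤j j≤d) = stop (final m) 1≤j j≤d
  run {m} (down ok t) = run-down m ok (run t)
  run (turn j<y τ t) = run-turn τ j<y (run t)

  data Parse (m : Mode) (i j : ℕ) : Word → Set where
    parsed : ∀ {xs ys} (t : Tail m i j xs ys) → Parse m i j (tailWord t)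

  -- The words read from the states 1, + and −: 𝗋s up to a column y, then the 𝖽-arc into
  -- mode m, whose sign τ is checked at (i, y).
  data Glide (m : Mode) (τ : Maybe Sign) (i j : ℕ) : Word → Set where
    glide : ∀ {y xs ys} → j ≤ y → SignOK ε τ i y → (t : Tail m (suc i) y xs ys) →
            Glide m τ i j (replicate (y ∸ j) 𝗋 ++ 𝖽 ∷ tailWord t)

  glide-right : ∀ {m τ i j w} → Glide m τ i (suc j) w → Glide m τ i j (𝗋 ∷ w)
  glide-right {m} {τ} {i} {j} (glide j<y ok t) =
    subst (Glide m τ i j) (cong (_++ 𝖽 ∷ tailWord t) (replicate-∸-suc 𝗋 j<y))
      (glide (≤-trans (n≤1+n j) j<y) ok t)

  glide-down : ∀ {m τ i j w} → SignOK ε τ i j → Parse m (suc i) j w → Glide m τ i j (𝖽 ∷ w)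
  glide-down {m} {τ} {i} {j} ok (parsed t) =
    subst (Glide m τ i j) (cong (λ n → replicate n 𝗋 ++ 𝖽 ∷ tailWord t) (n∸n≡0 j))
      (glide ≤-refl ok t)

  parse-turn : ∀ {m m′ σ i j w} → (∀ {y} → ε ⟨ i , y ⟩≡ σ → Turn i j y m m′) →
    Glide m′ (just σ) i (suc j) w → Parse m i j (𝗋 ∷ w)
  parse-turn turn-at (glide j<y ok t) = parsed (turn j<y (turn-at ok) t)

  parse : ∀ m {i j w} → Run ε (state m) i j w → Parse m i j w
  glide⁺ : ∀ {i j w} → Run ε s+ i j w → Glide pm (just neg) i j w
  glide⁻ : ∀ {i j w} → Run ε s- i j w → Glide mp (just pos) i j w

  parse m (stop _ 1≤j j≤d) = parsed (done 1≤j j≤d)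
  parse pm (step aPMpdPM refl refl ok r) with parse pm r
  ... | parsed t = parsed (down ok t)
  parse pm (step aPMprP refl refl ok r) = parse-turn (+- ok) (glide⁺ r)
  parse pm (step aPMmrM refl refl ok r) = parse-turn (-+ ok) (glide⁻ r)
  parse mp (step aMPpdMP refl refl ok r) with parse mp r
  ... | parsed t = parsed (down ok t)
  parse mp (step aMPmrM refl refl ok r) = parse-turn (-+ ok) (glide⁻ r)

  glide⁺ (stop () _ _)
  glide⁺ (step aPrP refl refl _ r) = glide-right (glide⁺ r)
  glide⁺ (step aPmdPM refl refl ok r) = glide-down ok (parse pm r)

  glide⁻ (stop () _ _)
  glide⁻ (step aMrM refl refl _ r) = glide-right (glide⁻ r)
  glide⁻ (step aMpdMP refl refl ok r) = glide-down ok (parse mp r)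

  glide¹ : ∀ {i j w} → Run ε s1 i j w → Glide pm nothing i j w
  glide¹ (stop () _ _)
  glide¹ (step a1r1 refl refl _ r) = glide-right (glide¹ r)
  glide¹ (step a1dPM refl refl ok r) = glide-down ok (parse pm r)

  tailWord-injective : ∀ {m m′ i j xs ys xs′ ys′}
    (t : Tail m i j xs ys) (t′ : Tail m′ i j xs′ ys′) →
    tailWord t ≡ tailWord t′ → xs ≡ xs′ × ys ≡ ys′
  tailWord-injective (done _ _) (done _ _) _ = refl , refl
  tailWord-injective (done _ _) (down _ _) ()
  tailWord-injective (down _ _) (done _ _) ()
  tailWord-injective (down _ t) (down _ t′) e = tailWord-injective t t′ (proj₂ (∷-injective e))
  tailWord-injective (down _ _) (turn _ _ _) ()
  tailWord-injective (turn _ _ _) (down _ _) ()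
  tailWord-injective (turn j<y _ t) (turn j<y′ _ t′) e
    with replicate-++-cancel 𝗋≢𝖽 _ _ (proj₂ (∷-injective e))
  ... | gaps , rest with ∸-cancelʳ-≡ j<y j<y′ gaps
  ... | refl with tailWord-injective t t′ rest
  ... | refl , refl = refl , refl

  glideWord-injective : ∀ {m m′ i j y y′ xs ys xs′ ys′}
    (t : Tail m (suc i) y xs ys) (t′ : Tail m′ (suc i) y′ xs′ ys′) → j ≤ y → j ≤ y′ →
    replicate (y ∸ j) 𝗋 ++ 𝖽 ∷ tailWord t ≡ replicate (y′ ∸ j) 𝗋 ++ 𝖽 ∷ tailWord t′ →
    y ≡ y′ × xs ≡ xs′ × ys ≡ ys′
  glideWord-injective t t′ j≤y j≤y′ e with replicate-++-cancel 𝗋≢𝖽 _ _ e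
  ... | gaps , rest with ∸-cancelʳ-≡ j≤y j≤y′ gaps
  ... | refl = refl , tailWord-injective t t′ rest

  -- IsLatticePath and TropicallyAllowed for the rows from i on; at i = 1 they are
  -- definitionally IsLatticePath and TropicallyAllowed.
  IsLatticeTail : ℕ → ℕ → List ℕ → List ℕ → Set
  IsLatticeTail i j xs ys =
    length (j ∷ ys) ≡ suc (length xs)
    × (∀ r → 1 ≤ r → r ≤ length xs → i ≤ at xs r × at xs r ≤ p)
    × (∀ r → 1 ≤ r → r < length xs → at xs r < at xs (suc r))
    × (∀ r → 1 ≤ r → r ≤ suc (length xs) → 1 ≤ at (j ∷ ys) r × at (j ∷ ys) r ≤ d)
    × (∀ r → 1 ≤ r → r < suc (length xs) → at (j ∷ ys) r < at (j ∷ ys) (suc r))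

  PlusMinusAt MinusPlusAt : List ℕ → List ℕ → ℕ → Set
  PlusMinusAt xs js r = ε ⟨ at xs r , at js r ⟩≡ pos × ε ⟨ at xs r , at js (suc r) ⟩≡ neg
  MinusPlusAt xs js r = ε ⟨ at xs r , at js r ⟩≡ neg × ε ⟨ at xs r , at js (suc r) ⟩≡ pos

  IsTropicalTail : ℕ → ℕ → List ℕ → List ℕ → Set
  IsTropicalTail i j xs ys =
    let k = length xs
        I = at xs
        J = at (j ∷ ys)
    in (1 ≤ k → ∀ a → i ≤ a → a < I 1 → ε ⟨ a , J 1 ⟩≡ pos)
     × (1 ≤ k → ∀ a → I k < a → a ≤ p → ε ⟨ a , J (suc k) ⟩≡ pos)
     × (k ≡ 0 → ∀ a → i ≤ a → a ≤ p → ε ⟨ a , J 1 ⟩≡ pos)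
     × (∀ r → 2 ≤ r → r ≤ k → ∀ a → I (r ∸ 1) < a → a < I r → ε ⟨ a , J r ⟩≡ pos)
     × (∀ r → 1 ≤ r → r ≤ k → PlusMinusAt xs (j ∷ ys) r ⊎ MinusPlusAt xs (j ∷ ys) r)
     × (∀ r s → 1 ≤ r → r ≤ s → s ≤ k →
          MinusPlusAt xs (j ∷ ys) r → MinusPlusAt xs (j ∷ ys) s)

  MinusPlusOnly : Mode → List ℕ → List ℕ → Set
  MinusPlusOnly pm xs js = ⊤
  MinusPlusOnly mp xs js = ∀ r → 1 ≤ r → r ≤ length xs → MinusPlusAt xs js r

  AllowedTail : Mode → ℕ → ℕ → List ℕ → List ℕ → Set
  AllowedTail m i j xs ys =
    IsLatticeTail i j xs ys × IsTropicalTail i j xs ys × MinusPlusOnly m xs (j ∷ ys)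

  minusPlusOnly-[] : ∀ m {js} → MinusPlusOnly m [] js
  minusPlusOnly-[] pm = tt
  minusPlusOnly-[] mp _ = vacuous-range

  allowedTail-done : ∀ {m j} → 1 ≤ j → j ≤ d → AllowedTail m (suc p) j [] []
  allowedTail-done {m} {j} 1≤j j≤d =
    (refl , (λ _ → vacuous-range) , (λ _ _ ()) , column , λ { zero () ; (suc _) _ (s≤s ()) })
    , ((λ ()) , (λ ())
      , (λ _ a p<a a≤p → ⊥-elim (1+n≰n (≤-trans p<a a≤p)))
      , (λ _ 2≤r → vacuous-range (≤-trans (s≤s z≤n) 2≤r))
      , (λ _ → vacuous-range)
      , (λ _ _ 1≤r r≤s → vacuous-range (≤-trans 1≤r r≤s)))
    , minusPlusOnly-[] m
    where
    column : ∀ r → 1 ≤ r → r ≤ 1 → 1 ≤ at (j ∷ []) r × at (j ∷ []) r ≤ d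
    column (suc zero) _ _ = 1≤j , j≤d
    column (suc (suc _)) _ (s≤s ())

  allowedTail-down : ∀ {m i j xs ys} → ε ⟨ i , j ⟩≡ pos →
    AllowedTail m (suc i) j xs ys → AllowedTail m i j xs ys
  allowedTail-down {i = i} ok
    ((len , row-bounds , rest) , (above , below , column , others) , later) =
    (len , (λ r 1≤r r≤k → map₁ (≤-trans (n≤1+n i)) (row-bounds r 1≤r r≤k)) , rest)
    , ((λ 1≤k → extend-downwards ok (above 1≤k)) , below ,
       (λ k≡0 → extend-downwards ok (column k≡0)) , others)
    , later

  latticeTail-turn : ∀ {i j y xs ys} → i ≤ p → 1 ≤ j → j ≤ d → j < y →
    IsLatticeTail (suc i) y xs ys → IsLatticeTail i j (i ∷ xs) (y ∷ ys)
  latticeTail-turn {i} {j} {y} {xs} {ys} i≤p 1≤j j≤d j<y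
    (len , row-bounds , rows< , col-bounds , cols<) =
    cong suc len , row-bounds′ , rows<′ , col-bounds′ , cols<′
    where
    row-bounds′ : ∀ r → 1 ≤ r → r ≤ suc (length xs) → i ≤ at (i ∷ xs) r × at (i ∷ xs) r ≤ p
    row-bounds′ (suc zero) _ _ = ≤-refl , i≤p
    row-bounds′ (suc (suc r)) _ (s≤s r<k) =
      map₁ (≤-trans (n≤1+n i)) (row-bounds (suc r) (s≤s z≤n) r<k)
    rows<′ : ∀ r → 1 ≤ r → r < suc (length xs) → at (i ∷ xs) r < at (i ∷ xs) (suc r)
    rows<′ (suc zero) _ (s≤s 1≤k) = proj₁ (row-bounds 1 (s≤s z≤n) 1≤k)
    rows<′ (suc (suc r)) _ (s≤s r<k) = rows< (suc r) (s≤s z≤n) r<k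
    col-bounds′ : ∀ r → 1 ≤ r → r ≤ suc (suc (length xs)) →
      1 ≤ at (j ∷ y ∷ ys) r × at (j ∷ y ∷ ys) r ≤ d
    col-bounds′ (suc zero) _ _ = 1≤j , j≤d
    col-bounds′ (suc (suc r)) _ (s≤s r≤k) = col-bounds (suc r) (s≤s z≤n) r≤k
    cols<′ : ∀ r → 1 ≤ r → r < suc (suc (length xs)) →
      at (j ∷ y ∷ ys) r < at (j ∷ y ∷ ys) (suc r)
    cols<′ (suc zero) _ _ = j<y
    cols<′ (suc (suc r)) _ (s≤s r<k) = cols< (suc r) (s≤s z≤n) r<k

  turn-signs : ∀ {m m′ i j y} → Turn i j y m m′ →
    (ε ⟨ i , j ⟩≡ pos × ε ⟨ i , y ⟩≡ neg) ⊎ (ε ⟨ i , j ⟩≡ neg × ε ⟨ i , y ⟩≡ pos)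
  turn-signs (+- ok ok′) = inj₁ (ok , ok′)
  turn-signs (-+ ok ok′) = inj₂ (ok , ok′)

  turn-from-minus : ∀ {m m′ i j y xs js} → Turn i j y m m′ → ε ⟨ i , j ⟩≡ neg →
    MinusPlusOnly m′ xs js → MinusPlusOnly mp xs js
  turn-from-minus {i = i} {j} (+- ok _) ok′ _ = ⊥-elim (pos≢neg {i} {j} ok ok′)
  turn-from-minus (-+ _ _) _ later = later

  minusPlusOnly-turn : ∀ {m m′ i j y xs ys} → Turn i j y m m′ →
    MinusPlusOnly m′ xs (y ∷ ys) → MinusPlusOnly m (i ∷ xs) (j ∷ y ∷ ys)
  minusPlusOnly-turn {pm} _ _ = tt
  minusPlusOnly-turn {mp} (-+ ok ok′) _ (suc zero) _ _ = ok , ok′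
  minusPlusOnly-turn {mp} (-+ _ _) later (suc (suc r)) _ (s≤s r≤k) =
    later (suc r) (s≤s z≤n) r≤k

  tropicalTail-turn : ∀ {m m′ i j y xs ys} → Turn i j y m m′ →
    IsTropicalTail (suc i) y xs ys → MinusPlusOnly m′ xs (y ∷ ys) →
    IsTropicalTail i j (i ∷ xs) (y ∷ ys)
  tropicalTail-turn {i = i} {j} {y} {xs} {ys} τ
    (above , below , column , between , turns , persist) later =
    (λ _ a i≤a a<i → ⊥-elim (<⇒≱ a<i i≤a)) , below′ xs below column , (λ ()) ,
    between′ , turns′ , persist′
    where
    K = suc (length xs)
    I = at (i ∷ xs)
    J = at (j ∷ y ∷ ys)
    below′ : ∀ xs →
      (1 ≤ length xs → ∀ a → at xs (length xs) < a → a ≤ p →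
         ε ⟨ a , at (y ∷ ys) (suc (length xs)) ⟩≡ pos) →
      (length xs ≡ 0 → ∀ a → suc i ≤ a → a ≤ p → ε ⟨ a , y ⟩≡ pos) →
      1 ≤ suc (length xs) → ∀ a → at (i ∷ xs) (suc (length xs)) < a → a ≤ p →
      ε ⟨ a , at (j ∷ y ∷ ys) (suc (suc (length xs))) ⟩≡ pos
    below′ [] _ column _ = column refl
    below′ (_ ∷ _) below _ _ = below (s≤s z≤n)
    between′ : ∀ r → 2 ≤ r → r ≤ K → ∀ a → I (r ∸ 1) < a → a < I r → ε ⟨ a , J r ⟩≡ pos
    between′ (suc zero) (s≤s ())
    between′ (suc (suc zero)) _ (s≤s 1≤k) = above 1≤k
    between′ (suc (suc (suc r))) _ (s≤s r<k) = between (suc (suc r)) (s≤s (s≤s z≤n)) r<k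
    turns′ : ∀ r → 1 ≤ r → r ≤ K →
      PlusMinusAt (i ∷ xs) (j ∷ y ∷ ys) r ⊎ MinusPlusAt (i ∷ xs) (j ∷ y ∷ ys) r
    turns′ (suc zero) _ _ = turn-signs τ
    turns′ (suc (suc r)) _ (s≤s r≤k) = turns (suc r) (s≤s z≤n) r≤k
    persist′ : ∀ r s → 1 ≤ r → r ≤ s → s ≤ K →
      MinusPlusAt (i ∷ xs) (j ∷ y ∷ ys) r → MinusPlusAt (i ∷ xs) (j ∷ y ∷ ys) s
    persist′ (suc zero) (suc zero) _ _ _ here = here
    persist′ (suc zero) (suc (suc s)) _ _ (s≤s s≤k) (ok , _) =
      turn-from-minus τ ok later (suc s) (s≤s z≤n) s≤k
    persist′ (suc (suc r)) (suc (suc s)) _ (s≤s r≤s) (s≤s s≤k) =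
      persist (suc r) (suc s) (s≤s z≤n) r≤s s≤k
    persist′ (suc (suc r)) (suc zero) _ (s≤s ()) _

  allowedTail-turn : ∀ {m m′ i j y xs ys} → j < y → Turn i j y m m′ →
    AllowedTail m′ (suc i) y xs ys → AllowedTail m i j (i ∷ xs) (y ∷ ys)
  allowedTail-turn j<y τ (L , T , later) with turn-bounds τ
  ... | _ , i≤p , 1≤j , j≤d =
    latticeTail-turn i≤p 1≤j j≤d j<y L , tropicalTail-turn τ T later , minusPlusOnly-turn τ later

  allowed-of-tail : ∀ {m i j xs ys} → Tail m i j xs ys → AllowedTail m i j xs ys
  allowed-of-tail (done 1≤j j≤d) = allowedTail-done 1≤j j≤d
  allowed-of-tail (down ok t) = allowedTail-down ok (allowed-of-tail t)
  allowed-of-tail (turn j<y τ t) = allowedTail-turn j<y τ (allowed-of-tail t)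

  latticeTail-next : ∀ {i j x y xs ys} →
    IsLatticeTail i j (x ∷ xs) (y ∷ ys) → IsLatticeTail (suc x) y xs ys
  latticeTail-next {x = x} {y} {xs} {ys} (len , row-bounds , rows< , col-bounds , cols<) =
    suc-injective len , row-bounds′ , rows<′ , col-bounds′ , cols<′
    where
    rows<′ : ∀ r → 1 ≤ r → r < length xs → at xs r < at xs (suc r)
    rows<′ (suc r) _ r<k = rows< (suc (suc r)) (s≤s z≤n) (s≤s r<k)
    row-bounds′ : ∀ r → 1 ≤ r → r ≤ length xs → suc x ≤ at xs r × at xs r ≤ p
    row-bounds′ (suc r) _ r≤k =
      <-≤-trans (rows< 1 (s≤s z≤n) (s≤s (≤-trans (s≤s z≤n) r≤k)))
                (increasing⇒first≤ (at xs) (length xs) rows<′ (suc r) (s≤s z≤n) r≤k)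
      , proj₂ (row-bounds (suc (suc r)) (s≤s z≤n) (s≤s r≤k))
    col-bounds′ : ∀ r → 1 ≤ r → r ≤ suc (length xs) → 1 ≤ at (y ∷ ys) r × at (y ∷ ys) r ≤ d
    col-bounds′ (suc r) _ r≤k = col-bounds (suc (suc r)) (s≤s z≤n) (s≤s r≤k)
    cols<′ : ∀ r → 1 ≤ r → r < suc (length xs) → at (y ∷ ys) r < at (y ∷ ys) (suc r)
    cols<′ (suc r) _ r<k = cols< (suc (suc r)) (s≤s z≤n) (s≤s r<k)

  tropicalTail-next : ∀ {i j x y xs ys} →
    IsTropicalTail i j (x ∷ xs) (y ∷ ys) → IsTropicalTail (suc x) y xs ys
  tropicalTail-next {j = j} {x} {y} {xs} {ys}
    (above , below , column , between , turns , persist) =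
    (λ 1≤k → between 2 ≤-refl (s≤s 1≤k)) , below′ xs below , column′ xs below ,
    between′ , turns′ , persist′
    where
    K = length xs
    I = at xs
    J = at (y ∷ ys)
    Below : List ℕ → Set
    Below xs = 1 ≤ suc (length xs) → ∀ a → at (x ∷ xs) (suc (length xs)) < a → a ≤ p →
               ε ⟨ a , at (j ∷ y ∷ ys) (suc (suc (length xs))) ⟩≡ pos
    below′ : ∀ xs → Below xs → 1 ≤ length xs → ∀ a → at xs (length xs) < a → a ≤ p →
      ε ⟨ a , at (y ∷ ys) (suc (length xs)) ⟩≡ pos
    below′ (_ ∷ _) below _ = below (s≤s z≤n)
    column′ : ∀ xs → Below xs → length xs ≡ 0 → ∀ a → suc x ≤ a → a ≤ p → ε ⟨ a , y ⟩≡ pos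
    column′ [] below refl = below (s≤s z≤n)
    between′ : ∀ r → 2 ≤ r → r ≤ K → ∀ a → I (r ∸ 1) < a → a < I r → ε ⟨ a , J r ⟩≡ pos
    between′ (suc zero) (s≤s ())
    between′ (suc (suc r)) _ r≤k = between (suc (suc (suc r))) (s≤s (s≤s z≤n)) (s≤s r≤k)
    turns′ : ∀ r → 1 ≤ r → r ≤ K → PlusMinusAt xs (y ∷ ys) r ⊎ MinusPlusAt xs (y ∷ ys) r
    turns′ (suc r) _ r≤k = turns (suc (suc r)) (s≤s z≤n) (s≤s r≤k)
    persist′ : ∀ r s → 1 ≤ r → r ≤ s → s ≤ K →
      MinusPlusAt xs (y ∷ ys) r → MinusPlusAt xs (y ∷ ys) s
    persist′ (suc r) (suc s) _ (s≤s r≤s) s≤k =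
      persist (suc (suc r)) (suc (suc s)) (s≤s z≤n) (s≤s (s≤s r≤s)) (s≤s s≤k)

  first-turn : ∀ {m i j x y xs ys} → AllowedTail m i j (x ∷ xs) (y ∷ ys) →
    Σ Mode λ m′ → Turn x j y m m′ × MinusPlusOnly m′ xs (y ∷ ys)
  first-turn {m} {j = j} {x} {y} {xs} {ys} (_ , (_ , _ , _ , _ , turns , persist) , earlier)
    with turns 1 (s≤s z≤n) (s≤s z≤n)
  ... | inj₂ (ok , ok′) = mp , -+ ok ok′ ,
    λ { (suc s) _ s≤k → persist 1 (suc (suc s)) ≤-refl (s≤s z≤n) (s≤s s≤k) (ok , ok′) }
  ... | inj₁ (ok , ok′) = pm , plus-minus m earlier , tt
    where
    plus-minus : ∀ m → MinusPlusOnly m (x ∷ xs) (j ∷ y ∷ ys) → Turn x j y m pm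
    plus-minus pm _ = +- ok ok′
    plus-minus mp earlier = ⊥-elim (pos≢neg {x} {j} ok (proj₁ (earlier 1 (s≤s z≤n) (s≤s z≤n))))

  descend : ∀ {m i x j xs ys} → i ≤′ x → (∀ a → i ≤ a → a < x → ε ⟨ a , j ⟩≡ pos) →
    Tail m x j xs ys → Tail m i j xs ys
  descend ≤′-refl _ t = t
  descend (≤′-step i≤′x) column t =
    descend i≤′x (λ a i≤a a<x → column a i≤a (m<n⇒m<1+n a<x))
      (down (column _ (≤′⇒≤ i≤′x) ≤-refl) t)

  tail-of-allowed : ∀ {m i j} xs ys → i ≤ suc p → AllowedTail m i j xs ys → Tail m i j xs ys
  tail-of-allowed [] [] i≤1+p ((_ , _ , _ , col-bounds , _) , (_ , _ , column , _) , _) =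
    descend (≤⇒≤′ i≤1+p) (λ a i≤a a≤p → column refl a i≤a (≤-pred a≤p))
      (done (proj₁ j-bounds) (proj₂ j-bounds))
    where j-bounds = col-bounds 1 (s≤s z≤n) (s≤s z≤n)
  tail-of-allowed [] (_ ∷ _) _ ((() , _) , _)
  tail-of-allowed (_ ∷ _) [] _ ((() , _) , _)
  tail-of-allowed (x ∷ xs) (y ∷ ys) _
    A@(L@(_ , row-bounds , _ , _ , cols<) , T@(above , _) , _) with first-turn A
  ... | _ , τ , later =
    descend (≤⇒≤′ (proj₁ x-bounds)) (above (s≤s z≤n))
      (turn (cols< 1 (s≤s z≤n) (s≤s (s≤s z≤n))) τ
        (tail-of-allowed xs ys (s≤s (proj₂ x-bounds))
          (latticeTail-next {xs = xs} {ys} L , tropicalTail-next {xs = xs} {ys} T , later)))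
    where x-bounds = row-bounds 1 (s≤s z≤n) (s≤s z≤n)

  path-tail : ∀ xs y ys → AllowedPath ε (path xs (y ∷ ys)) → Tail pm 1 y xs ys
  path-tail xs y ys (L , T) = tail-of-allowed xs ys (s≤s z≤n) (L , T , tt)

  allowed⇒accepted : (P : Path) → AllowedPath ε P → Accepted ε (pathWord p P)
  allowed⇒accepted (path _ []) ((() , _) , _)
  allowed⇒accepted (path xs (y ∷ ys)) A =
    subst (Accepted ε) (sym (pathWord′-tailWord t z≤n))
      (run-loop a1r1 refl refl refl (proj₁ (tail-column-bounds t))
        (step a1dPM refl refl tt (run t)))
    where t = path-tail xs y ys A

  pathWord-injective : (P Q : Path) → AllowedPath ε P → AllowedPath ε Q →
    pathWord p P ≡ pathWord p Q → P ≡ Q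
  pathWord-injective (path _ []) _ ((() , _) , _) _ _
  pathWord-injective (path _ (_ ∷ _)) (path _ []) _ ((() , _) , _) _
  pathWord-injective (path xs (y ∷ ys)) (path xs′ (y′ ∷ ys′)) A A′ e
    with glideWord-injective t t′ (proj₁ (tail-column-bounds t)) (proj₁ (tail-column-bounds t′))
           (trans (sym (pathWord′-tailWord t z≤n)) (trans e (pathWord′-tailWord t′ z≤n)))
    where
    t = path-tail xs y ys A
    t′ = path-tail xs′ y′ ys′ A′
  ... | refl , refl , refl = refl

  accepted⇒allowed : (w : Word) → Accepted ε w →
    Σ Path (λ P → AllowedPath ε P × pathWord p P ≡ w)
  accepted⇒allowed w r with glide¹ r
  ... | glide {xs = xs} {ys} _ _ t with allowed-of-tail t
  ... | L , T , _ = path xs (_ ∷ ys) , (L , T) , pathWord′-tailWord t z≤n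

proposition15 : (p d : ℕ) → 1 ≤ p → 1 ≤ d → (ε : SignTable p d) →
    ((P : Path) → AllowedPath ε P → Accepted ε (pathWord p P))
    × ((P Q : Path) → AllowedPath ε P → AllowedPath ε Q →
        pathWord p P ≡ pathWord p Q → P ≡ Q)
    × ((w : Word) → Accepted ε w →
        Σ Path (λ P → AllowedPath ε P × pathWord p P ≡ w))
    × ((w : Word) (r₁ r₂ : Accepted ε w) → arcs r₁ ≡ arcs r₂)
proposition15 p d _ _ ε =
  allowed⇒accepted ε , pathWord-injective ε , accepted⇒allowed ε , λ _ → arcs-unique ε
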